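{- Let $k$ be an integer and let $G$ be a non-complete double-critical $k$-chromatic graph. For any vertex $x$ that is not adjacent to all other vertices of $G$, the neighbourhood graph $G_x=G[N(x)]$ satisfies $\chi(G_x)\le k-3$.
   Context: All graphs are finite and simple. A graph $G$ is (vertex-)critical if $\chi(G-v)<\chi(G)$ for every vertex $v$. A critical graph $G$ is double-critical if $\chi(G-x-y)\le \chi(G)-2$ for every edge $xy\in E(G)$ (here $G-x-y$ denotes deletion of both end-vertices). $N(x)$ denotes the set of neighbours of $x$. -}

module Defs where

open import Data.Nat using (ℕ; _≤_; _<_; _+_)
open import Data.Fin using (Fin)
open import Data.Bool using (Bool; true; false)
open import Data.Product using (Σ; ∃; _×_)
open import Relation.Nullary using (¬_)
open import Relation.Binary.PropositionalEquality using (_≡_; _≢_)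

record Graph : Set where
  field
    n     : ℕ
    adj   : Fin n → Fin n → Bool
    sym   : ∀ u v → adj u v ≡ adj v u
    irrefl : ∀ v → adj v v ≡ false
open Graph public

Adj : (G : Graph) → Fin (n G) → Fin (n G) → Set
Adj G u v = adj G u v ≡ true

VSet : Graph → Set₁
VSet G = Fin (n G) → Set

ColorableOn : (G : Graph) → VSet G → ℕ → Set
ColorableOn G S c =
  Σ ((v : Fin (n G)) → S v → Fin c) λ f →
    ∀ u v (su : S u) (sv : S v) → Adj G u v → f u su ≢ f v sv

ChromaticNumberOn : (G : Graph) → VSet G → ℕ → Set
ChromaticNumberOn G S k =
  ColorableOn G S k × (∀ c → ColorableOn G S c → k ≤ c)

All : (G : Graph) → VSet G
All G _ = Data.Unit.⊤
  where import Data.Unit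

Minus : (G : Graph) → Fin (n G) → VSet G
Minus G v w = w ≢ v

Minus2 : (G : Graph) → Fin (n G) → Fin (n G) → VSet G
Minus2 G x y w = (w ≢ x) × (w ≢ y)

Nbhd : (G : Graph) → Fin (n G) → VSet G
Nbhd G x w = Adj G x w

ChromaticNumber : Graph → ℕ → Set
ChromaticNumber G k = ChromaticNumberOn G (All G) k

CriticalKChromatic : Graph → ℕ → Set
CriticalKChromatic G k =
  ChromaticNumber G k ×
  (∀ v → ∃ λ c → c < k × ColorableOn G (Minus G v) c)

DoubleCriticalKChromatic : Graph → ℕ → Set
DoubleCriticalKChromatic G k =
  CriticalKChromatic G k ×
  (∀ x y → Adj G x y → ∃ λ c → c + 2 ≤ k × ColorableOn G (Minus2 G x y) c)

Complete : Graph → Set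
Complete G = ∀ u v → u ≢ v → Adj G u v

module Submission where

-- In a critical graph no vertex is dominated: if y ≠ x and
-- N(y) ⊆ N(x), a (k-1)-colouring of G - y extends to G by giving y the
-- colour of x.  Hence y has a neighbour w with w ∉ N(x).  By
-- double-criticality G - y - w has a colouring with c ≤ k - 2 colours, and
-- both x and N(x) avoid y and w.  In that colouring no neighbour of x uses
-- x's colour, so N(x) is coloured with the remaining c - 1 ≤ k - 3 colours.

open import Defs
open import Data.Nat using (ℕ; _≤_; _+_; zero; suc)
open import Data.Nat.Properties using (<⇒≱; +-suc)
open import Data.Fin using (Fin; punchOut; _≟_)
open import Data.Fin.Properties using (punchOut-injective; ¬∀⟶∃¬)
import Data.Bool.Properties as Bool
open import Data.Product using (∃; _×_; _,_)
open import Relation.Nullary using (¬_; yes; no; Dec; contradiction)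
open import Relation.Nullary.Decidable using (_→-dec_)
open import Relation.Binary.PropositionalEquality
  using (_≢_; _≡_; refl; trans; subst) renaming (sym to ≡-sym)

adj-sym : (G : Graph) {u v : Fin (n G)} → Adj G u v → Adj G v u
adj-sym G {u} {v} uv = trans (Graph.sym G v u) uv

adj-distinct : (G : Graph) {u v : Fin (n G)} → Adj G u v → u ≢ v
adj-distinct G {u} uu refl with trans (≡-sym uu) (irrefl G u)
... | ()

adj? : (G : Graph) (u v : Fin (n G)) → Dec (Adj G u v)
adj? G u v = adj G u v Bool.≟ _

colours-nonempty : (G : Graph) {S : VSet G} {c : ℕ} {x : Fin (n G)} →
  S x → ColorableOn G S c → ∃ λ c′ → c ≡ suc c′
colours-nonempty G {c = suc c′} _ _ = c′ , refl
colours-nonempty G {c = zero} {x} sx (f , _) with f x sx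
... | ()

-- If x and all its neighbours lie in S, then in any (c+1)-colouring of G[S]
-- the neighbours of x avoid x's colour; removing that colour (punchOut)
-- colours G[N(x)] with c colours.
neighbourhood-colouring : (G : Graph) {S : VSet G} {c : ℕ} (x : Fin (n G)) →
  S x → (∀ v → Adj G x v → S v) →
  ColorableOn G S (suc c) → ColorableOn G (Nbhd G x) c
neighbourhood-colouring G x sx N⊆S (f , proper) = recolour , recolour-proper
  where
  differs : ∀ v (xv : Adj G x v) → f x sx ≢ f v (N⊆S v xv)
  differs v xv = proper x v sx (N⊆S v xv) xv

  recolour : (v : Fin (n G)) → Nbhd G x v → Fin _
  recolour v xv = punchOut (differs v xv)

  recolour-proper : ∀ u v (xu : Nbhd G x u) (xv : Nbhd G x v) →
    Adj G u v → recolour u xu ≢ recolour v xv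
  recolour-proper u v xu xv uv same =
    proper u v (N⊆S u xu) (N⊆S v xv) uv
      (punchOut-injective (differs u xu) (differs v xv) same)

-- A colouring of G - y extends to G when y is dominated by some x ≠ y
-- (N(y) ⊆ N(x)): give y the colour of x.
extend-dominated : (G : Graph) {c : ℕ} (x y : Fin (n G)) → x ≢ y →
  (∀ w → Adj G y w → Adj G x w) →
  ColorableOn G (Minus G y) c → ColorableOn G (All G) c
extend-dominated G x y x≢y dominated (g , proper) =
  (λ v _ → colour v (v ≟ y)) ,
  (λ u v _ _ → colour-proper u v (u ≟ y) (v ≟ y))
  where
  colour : (v : Fin (n G)) → Dec (v ≡ y) → Fin _
  colour v (yes _)  = g x x≢y
  colour v (no v≢y) = g v v≢y

  colour-proper : ∀ u v (u? : Dec (u ≡ y)) (v? : Dec (v ≡ y)) →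
    Adj G u v → colour u u? ≢ colour v v?
  colour-proper u v (yes refl) (yes refl) uv  = contradiction refl (adj-distinct G uv)
  colour-proper u v (yes refl) (no v≢y)   uv  = proper x v x≢y v≢y (dominated v uv)
  colour-proper u v (no u≢y)   (yes refl) uv e =
    proper x u x≢y u≢y (dominated u (adj-sym G uv)) (≡-sym e)
  colour-proper u v (no u≢y)   (no v≢y)   uv  = proper u v u≢y v≢y uv

-- In a critical k-chromatic graph no vertex y is dominated by another x:
-- otherwise the (k-1)-colouring of G - y would extend to G.
no-domination : (G : Graph) (k : ℕ) → CriticalKChromatic G k →
  (x y : Fin (n G)) → x ≢ y → ¬ (∀ w → Adj G y w → Adj G x w)
no-domination G k ((_ , minimal) , critical) x y x≢y dominated
  with critical y
... | c , c<k , colouring =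
  <⇒≱ c<k (minimal c (extend-dominated G x y x≢y dominated colouring))

private-neighbour : (G : Graph) (x y : Fin (n G)) →
  ¬ (∀ w → Adj G y w → Adj G x w) → ∃ λ w → Adj G y w × ¬ Adj G x w
private-neighbour G x y not-dominated
  with ¬∀⟶∃¬ (n G) _ (λ w → adj? G y w →-dec adj? G x w) not-dominated
... | w , ¬[yw⇒xw] with adj? G y w | adj? G x w
...   | _      | yes xw = contradiction (λ _ → xw) ¬[yw⇒xw]
...   | yes yw | no ¬xw = w , yw , ¬xw
...   | no ¬yw | no _   = contradiction (λ yw → contradiction yw ¬yw) ¬[yw⇒xw]

-- If x ≁ y and x ≁ w for an edge yw, then x and all its neighbours lie in
-- G - y - w: neighbours of x are neither y nor w, and x itself is neither y
-- (by assumption) nor w (since w ∼ y ≁ x).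
avoids-edge : (G : Graph) {x y w : Fin (n G)} → y ≢ x → ¬ Adj G x y →
  Adj G y w → ¬ Adj G x w →
  Minus2 G y w x × (∀ v → Adj G x v → Minus2 G y w v)
avoids-edge G y≢x ¬xy yw ¬xw =
  ((λ x≡y → y≢x (≡-sym x≡y)) , λ { refl → ¬xy (adj-sym G yw) }) ,
  (λ v xv → (λ { refl → ¬xy xv }) , (λ { refl → ¬xw xv }))

proposition13 : (G : Graph) (k : ℕ) → ¬ Complete G → DoubleCriticalKChromatic G k →
    (x : Fin (n G)) → (∃ λ y → y ≢ x × ¬ Adj G x y) →
    ∃ λ c → c + 3 ≤ k × ColorableOn G (Nbhd G x) c
proposition13 G k _ (critical , double-critical) x (y , y≢x , ¬xy)
  with private-neighbour G x y
         (no-domination G k critical x y (λ x≡y → y≢x (≡-sym x≡y)))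
... | w , yw , ¬xw with double-critical y w yw | avoids-edge G y≢x ¬xy yw ¬xw
...   | c , c+2≤k , colouring | x∈S , N[x]⊆S
        with colours-nonempty G x∈S colouring
...     | c′ , refl =
  c′ , subst (_≤ k) (≡-sym (+-suc c′ 2)) c+2≤k ,
  neighbourhood-colouring G x x∈S N[x]⊆S colouring
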